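{- Let $p>3$ be a prime and for nonnegative integers $n,k$ let $$F(n,k)=(-1)^{n+k}\frac{20n-2k+3}{4^{5n-k}}\cdot\frac{\binom{2n}{n}\binom{4n+2k}{2n+k}\binom{2n-k}{n}\binom{2n+k}{2k}}{\binom{2k}{k}}.$$ Then $$F(p-1,p-1)\equiv 15p^2\left(-1-6p+8pq_p(2)\right)\pmod{p^4}.$$
   Context: $q_p(2)=(2^{p-1}-1)/p$ is the Fermat quotient. Congruences between rational numbers are understood in the ring of rationals whose denominators are coprime to $p$. -}

module Defs where

open import Data.Nat as ℕ using (ℕ; zero; suc)
open import Data.Nat.Combinatorics using (_C_)
open import Data.Nat.Coprimality using (Coprime)
open import Data.Integer as ℤ using (ℤ; +_)
open import Data.Rational as ℚ using (ℚ; _/_; ↧ₙ_)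
open import Data.Product using (Σ; _×_)
open import Relation.Binary.PropositionalEquality using (_≡_)

-- a / d as a rational, for a natural-number denominator d.
-- (Total version: returns 0 when d = 0; only ever used with d ≠ 0.)
frac : ℤ → ℕ → ℚ
frac a zero    = ℚ.0ℚ
frac a (suc d) = a / suc d

sgn : ℕ → ℤ
sgn zero          = + 1
sgn (suc zero)    = ℤ.- (+ 1)
sgn (suc (suc m)) = sgn m

-- F(n,k) = (-1)^(n+k) (20n-2k+3)/4^(5n-k) *
--          C(2n,n) C(4n+2k,2n+k) C(2n-k,n) C(2n+k,2k) / C(2k,k)
-- (the truncated subtractions 2n-k, 5n-k are exact for k ≤ n, the case used)
F : ℕ → ℕ → ℚ
F n k =
  frac (sgn (n ℕ.+ k)
         ℤ.* ((+ (20 ℕ.* n) ℤ.- + (2 ℕ.* k)) ℤ.+ + 3)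
         ℤ.* + ( ((2 ℕ.* n) C n)
               ℕ.* ((4 ℕ.* n ℕ.+ 2 ℕ.* k) C (2 ℕ.* n ℕ.+ k))
               ℕ.* ((2 ℕ.* n ℕ.∸ k) C n)
               ℕ.* ((2 ℕ.* n ℕ.+ k) C (2 ℕ.* k))))
       ((4 ℕ.^ (5 ℕ.* n ℕ.∸ k)) ℕ.* ((2 ℕ.* k) C k))

fermatQuotient2 : ℕ → ℚ
fermatQuotient2 p = frac (+ (2 ℕ.^ (p ℕ.∸ 1)) ℤ.- + 1) p

pIntegral : ℕ → ℚ → Set
pIntegral p r = Coprime (↧ₙ r) p

-- a ≡ b (mod m) in the ring of rationals with denominators coprime to p:
-- a - b = m * r for some p-integral r
CongMod : ℕ → ℚ → ℚ → ℕ → Set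
CongMod p a b m = Σ ℚ (λ r → pIntegral p r × (a ℚ.- b ≡ frac (+ m) 1 ℚ.* r))

-- For n = p - 1 the summand collapses to F(n,n) = (18n+3) T / 4^(4n), where
-- T = C(6n,3n) C(3n,n) = (6n)! / ((3n)! (2n)! n!).  Comparing T with the same
-- multinomial coefficient T′ at (3p, 2p, p) gives
--   T (6p-5)(6p-4)⋯(6p-1) = T′ p² (3p-2)(3p-1)(2p-1),
-- and Babbage's congruence C(ap, bp) ≡ C(a, b) (mod p²) gives T′ ≡ C(6,3) C(3,2) = 60.
-- Since (6p-5)⋯(6p-1) is prime to p when p > 5, this yields
-- (18n+3) T ≡ -15p² (6p+1) (mod p⁴).  On the other side Fermat gives 2^(p-1) = 1 + qp,
-- so 8p q_p(2) = 8qp and 4^(4n) = (1 + qp)^8 ≡ 1 + 8qp (mod p²), which reconciles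
-- the two sides modulo p⁴.  The case p = 5 is checked numerically.

module Submission where

open import Defs

open import Data.Nat as ℕ
open import Data.Nat.Properties
open import Data.Nat.DivMod
open import Data.Nat.Divisibility
open import Data.Nat.Primality
open import Data.Nat.GCD using (gcd)
open import Data.Nat.Combinatorics using (_C_; nCk+nC[k+1]≡[n+1]C[k+1]; k>n⇒nCk≡0; nCn≡1; nC1≡n; nCk≡n!/k![n-k]!; k![n∸k]!∣n!)
open import Data.Nat.Tactic.RingSolver using (solve-∀)
open import Data.Product using (∃; _,_; proj₁; proj₂)
open import Data.Sum using (inj₁; inj₂; [_,_]′)
open import Function using (_∘_)
open import Relation.Nullary using (contradiction)
import Data.Integer as ℤ
import Data.Integer.Properties as ℤ
open import Data.Integer.Divisibility.Signed using (divides) renaming (_∣_ to _∣ℤ_)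
import Data.Integer.Tactic.RingSolver as ℤ-Solver
open import Data.Rational as ℚ using (↧ₙ_)
import Data.Rational.Properties as ℚ
import Data.Rational.Unnormalised as ℚᵘ
import Data.Rational.Unnormalised.Properties as ℚᵘ
open import Level using (0ℓ)
open import Relation.Binary.Bundles using (Setoid)
import Relation.Binary.Reasoning.Setoid as SetoidReasoning
open import Relation.Binary.PropositionalEquality hiding ([_])

-- A record rather than a definition, so that _%_ is not unfolded when implicit
-- arguments are inferred.
infix 4 _≡_[mod_]
record _≡_[mod_] (a b m : ℕ) .{{_ : NonZero m}} : Set where
  constructor mod-≡
  field %-≡ : a % m ≡ b % m

≡-mod-setoid : (m : ℕ) .{{_ : NonZero m}} → Setoid 0ℓ 0ℓ
≡-mod-setoid m = record
  { Carrier       = ℕ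
  ; _≈_           = _≡_[mod m ]
  ; isEquivalence = record
    { refl  = mod-≡ refl
    ; sym   = λ (mod-≡ a≡b) → mod-≡ (sym a≡b)
    ; trans = λ (mod-≡ a≡b) (mod-≡ b≡c) → mod-≡ (trans a≡b b≡c)
    }
  }

module _ {m : ℕ} .{{_ : NonZero m}} where

  +-cong-mod : ∀ {a b c d} → a ≡ b [mod m ] → c ≡ d [mod m ] → a + c ≡ b + d [mod m ]
  +-cong-mod {a} {b} {c} {d} (mod-≡ a≡b) (mod-≡ c≡d) = mod-≡ (begin
    (a + c) % m           ≡⟨ %-distribˡ-+ a c m ⟩
    (a % m + c % m) % m   ≡⟨ cong₂ (λ x y → (x + y) % m) a≡b c≡d ⟩
    (b % m + d % m) % m   ≡⟨ %-distribˡ-+ b d m ⟨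
    (b + d) % m           ∎)
    where open ≡-Reasoning

  *-cong-mod : ∀ {a b c d} → a ≡ b [mod m ] → c ≡ d [mod m ] → a * c ≡ b * d [mod m ]
  *-cong-mod {a} {b} {c} {d} (mod-≡ a≡b) (mod-≡ c≡d) = mod-≡ (begin
    (a * c) % m           ≡⟨ %-distribˡ-* a c m ⟩
    (a % m * (c % m)) % m ≡⟨ cong₂ (λ x y → (x * y) % m) a≡b c≡d ⟩
    (b % m * (d % m)) % m ≡⟨ %-distribˡ-* b d m ⟨
    (b * d) % m           ∎)
    where open ≡-Reasoning

  +-∣-modʳ : ∀ a {d} → m ∣ d → a + d ≡ a [mod m ]
  +-∣-modʳ a m∣d = mod-≡ (%-remove-+ʳ a m∣d)

  +-∣-modˡ : ∀ a {d} → m ∣ d → d + a ≡ a [mod m ]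
  +-∣-modˡ a m∣d = mod-≡ (%-remove-+ˡ a m∣d)

  ≡0-mod⇒∣ : ∀ {a} → a ≡ 0 [mod m ] → m ∣ a
  ≡0-mod⇒∣ {a} (mod-≡ a≡0) = m%n≡0⇒n∣m a m (trans a≡0 (m*n%n≡0 0 m))

*-congʳ-mod : ∀ {d m} .{{_ : NonZero d}} .{{_ : NonZero m}} {a b} k →
              m ∣ d * k → a ≡ b [mod d ] → a * k ≡ b * k [mod m ]
*-congʳ-mod {m = m} {a} {b} zero      _    _             = mod-≡ (cong (_% m) (trans (*-zeroʳ a) (sym (*-zeroʳ b))))
*-congʳ-mod {d} {m} {a} {b} k@(suc _) m∣dk (mod-≡ a≡b) = mod-≡ (begin
  (a * k) % m             ≡⟨ m∣n⇒o%n%m≡o%m m (d * k) (a * k) m∣dk ⟨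
  (a * k) % (d * k) % m   ≡⟨ cong (_% m) (m%n*o≡m*o%[n*o] a d k) ⟨
  (a % d * k) % m         ≡⟨ cong (λ x → (x * k) % m) a≡b ⟩
  (b % d * k) % m         ≡⟨ cong (_% m) (m%n*o≡m*o%[n*o] b d k) ⟩
  (b * k) % (d * k) % m   ≡⟨ m∣n⇒o%n%m≡o%m m (d * k) (b * k) m∣dk ⟩
  (b * k) % m             ∎)
  where
  open ≡-Reasoning
  instance _ = m*n≢0 d k

[1+x]^e≡1+ex : ∀ {m} .{{_ : NonZero m}} {x} e → m ∣ x * x → (1 + x) ^ e ≡ 1 + e * x [mod m ]
[1+x]^e≡1+ex         zero    _      = mod-≡ refl
[1+x]^e≡1+ex {m} {x} (suc e) m∣x*x = begin
  (1 + x) * (1 + x) ^ e       ≈⟨ *-cong-mod {a = 1 + x} (mod-≡ refl) ([1+x]^e≡1+ex e m∣x*x) ⟩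
  (1 + x) * (1 + e * x)       ≡⟨ expand x e ⟩
  1 + suc e * x + e * (x * x) ≈⟨ +-∣-modʳ (1 + suc e * x) (∣n⇒∣m*n e m∣x*x) ⟩
  1 + suc e * x               ∎
  where
  open SetoidReasoning (≡-mod-setoid m)
  expand : ∀ x e → (1 + x) * (1 + e * x) ≡ 1 + (1 + e) * x + e * (x * x)
  expand = solve-∀

≡-mod⇒∣- : ∀ {a b m} .{{_ : NonZero m}} → a ≡ b [mod m ] → ℤ.+ m ∣ℤ ℤ.+ a ℤ.- ℤ.+ b
≡-mod⇒∣- {a} {b} {m} (mod-≡ a%m≡b%m) = divides (ℤ.+ (a / m) ℤ.- ℤ.+ (b / m)) (begin
  ℤ.+ a ℤ.- ℤ.+ b
    ≡⟨ cong₂ (λ x y → ℤ.+ x ℤ.- ℤ.+ y) (m≡m%n+[m/n]*n a m) (m≡m%n+[m/n]*n b m) ⟩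
  ℤ.+ (a % m + a / m * m) ℤ.- ℤ.+ (b % m + b / m * m)
    ≡⟨ cong (λ r → ℤ.+ (a % m + a / m * m) ℤ.- ℤ.+ (r + b / m * m)) a%m≡b%m ⟨
  r ℤ.+ ℤ.+ (a / m * m) ℤ.- (r ℤ.+ ℤ.+ (b / m * m))
    ≡⟨ cong₂ (λ x y → r ℤ.+ x ℤ.- (r ℤ.+ y)) (ℤ.pos-* (a / m) m) (ℤ.pos-* (b / m) m) ⟩
  r ℤ.+ x ℤ.* M ℤ.- (r ℤ.+ y ℤ.* M)
    ≡⟨ cancel r x y M ⟩
  (x ℤ.- y) ℤ.* M ∎)
  where
  open ≡-Reasoning
  r = ℤ.+ (a % m)
  x = ℤ.+ (a / m)
  y = ℤ.+ (b / m)
  M = ℤ.+ m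
  cancel : ∀ r x y m → r ℤ.+ x ℤ.* m ℤ.- (r ℤ.+ y ℤ.* m) ≡ (x ℤ.- y) ℤ.* m
  cancel = ℤ-Solver.solve-∀

toℚᵘ-frac : ∀ a d .{{_ : NonZero d}} → ℚ.toℚᵘ (frac a d) ℚᵘ.≃ a ℚᵘ./ d
toℚᵘ-frac a (suc d) = ℚ.toℚᵘ-fromℚᵘ (ℚᵘ.mkℚᵘ a d)

toℚᵘ≃⇒≡frac : ∀ {x} a d .{{_ : NonZero d}} → ℚ.toℚᵘ x ℚᵘ.≃ a ℚᵘ./ d → x ≡ frac a d
toℚᵘ≃⇒≡frac a d x≃a/d = ℚ.toℚᵘ-injective (ℚᵘ.≃-trans x≃a/d (ℚᵘ.≃-sym (toℚᵘ-frac a d)))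

frac-≡ : ∀ {a b c d} .{{_ : NonZero b}} .{{_ : NonZero d}} → a ℤ.* ℤ.+ d ≡ c ℤ.* ℤ.+ b → frac a b ≡ frac c d
frac-≡ {a} {suc b} {c} {suc d} eq = ℚ.fromℚᵘ-cong {ℚᵘ.mkℚᵘ a b} {ℚᵘ.mkℚᵘ c d} (ℚᵘ.*≡* eq)

frac-neg : ∀ a d .{{_ : NonZero d}} → ℚ.- frac a d ≡ frac (ℤ.- a) d
frac-neg a d@(suc _) = toℚᵘ≃⇒≡frac (ℤ.- a) d (ℚᵘ.≃-trans (ℚ.toℚᵘ-homo‿- (frac a d)) (ℚᵘ.-‿cong (toℚᵘ-frac a d)))

frac-+ : ∀ a b c d .{{_ : NonZero b}} .{{_ : NonZero d}} →
         frac a b ℚ.+ frac c d ≡ frac (a ℤ.* ℤ.+ d ℤ.+ c ℤ.* ℤ.+ b) (b * d)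
frac-+ a b@(suc _) c d@(suc _) = toℚᵘ≃⇒≡frac _ (b * d)
  (ℚᵘ.≃-trans (ℚ.toℚᵘ-homo-+ (frac a b) (frac c d)) (ℚᵘ.+-cong (toℚᵘ-frac a b) (toℚᵘ-frac c d)))

frac-* : ∀ a b c d .{{_ : NonZero b}} .{{_ : NonZero d}} →
         frac a b ℚ.* frac c d ≡ frac (a ℤ.* c) (b * d)
frac-* a b@(suc _) c d@(suc _) = toℚᵘ≃⇒≡frac _ (b * d)
  (ℚᵘ.≃-trans (ℚ.toℚᵘ-homo-* (frac a b) (frac c d)) (ℚᵘ.*-cong (toℚᵘ-frac a b) (toℚᵘ-frac c d)))

↧ₙ-frac∣ : ∀ a d .{{_ : NonZero d}} → ↧ₙ frac a d ∣ d
↧ₙ-frac∣ a d@(suc _) = divides g (trans (sym (ℤ.+-injective (trans (ℤ.pos-* (↧ₙ frac a d) g) (ℚ.↧-/ a d))))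
                                       (*-comm (↧ₙ frac a d) g))
  where g = gcd ℤ.∣ a ∣ d

pIntegral-frac : ∀ {p} → Prime p → ∀ a d .{{_ : NonZero d}} → p ∤ d → pIntegral p (frac a d)
pIntegral-frac p-prime a d p∤d (i∣den , i∣p) with prime⇒irreducible p-prime i∣p
... | inj₁ i≡1 = i≡1
... | inj₂ refl = contradiction (∣-trans i∣den (↧ₙ-frac∣ a d)) p∤d

congMod-frac : ∀ {p m a b d} .{{_ : NonZero d}} → Prime p → p ∤ d →
               ℤ.+ m ∣ℤ a ℤ.- b ℤ.* ℤ.+ d → CongMod p (frac a d) (frac b 1) m
congMod-frac {m = m} {a} {b} {d@(suc _)} p-prime p∤d (divides k a-bd≡km) = frac k d , pIntegral-frac p-prime k d p∤d , (begin
  frac a d ℚ.+ ℚ.- frac b 1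
    ≡⟨ cong (frac a d ℚ.+_) (frac-neg b 1) ⟩
  frac a d ℚ.+ frac (ℤ.- b) 1
    ≡⟨ frac-+ a d (ℤ.- b) 1 ⟩
  frac (a ℤ.* ℤ.+ 1 ℤ.+ ℤ.- b ℤ.* ℤ.+ d) (d * 1)
    ≡⟨ frac-≡ {a ℤ.* ℤ.+ 1 ℤ.+ ℤ.- b ℤ.* D} {c = ℤ.+ m ℤ.* k} {{m*n≢0 d 1}} {{m*n≢0 1 d}} cross ⟩
  frac (ℤ.+ m ℤ.* k) (1 * d)
    ≡⟨ frac-* (ℤ.+ m) 1 k d ⟨
  frac (ℤ.+ m) 1 ℚ.* frac k d ∎)
  where
  open ≡-Reasoning
  D = ℤ.+ d
  cross : (a ℤ.* ℤ.+ 1 ℤ.+ ℤ.- b ℤ.* D) ℤ.* ℤ.+ (1 * d) ≡ ℤ.+ m ℤ.* k ℤ.* ℤ.+ (d * 1)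
  cross = begin
    (a ℤ.* ℤ.+ 1 ℤ.+ ℤ.- b ℤ.* D) ℤ.* ℤ.+ (1 * d)
      ≡⟨ cong (λ x → (a ℤ.* ℤ.+ 1 ℤ.+ ℤ.- b ℤ.* D) ℤ.* ℤ.+ x) (*-identityˡ d) ⟩
    (a ℤ.* ℤ.+ 1 ℤ.+ ℤ.- b ℤ.* D) ℤ.* D
      ≡⟨ collect a b D ⟩
    (a ℤ.- b ℤ.* D) ℤ.* D
      ≡⟨ cong (ℤ._* D) a-bd≡km ⟩
    k ℤ.* ℤ.+ m ℤ.* D
      ≡⟨ cong₂ ℤ._*_ (ℤ.*-comm k (ℤ.+ m)) (cong ℤ.+_ (sym (*-identityʳ d))) ⟩
    ℤ.+ m ℤ.* k ℤ.* ℤ.+ (d * 1) ∎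
    where
    collect : ∀ a b D → (a ℤ.* ℤ.+ 1 ℤ.+ ℤ.- b ℤ.* D) ℤ.* D ≡ (a ℤ.- b ℤ.* D) ℤ.* D
    collect = ℤ-Solver.solve-∀

∑< : ℕ → (ℕ → ℕ) → ℕ
∑< zero    f = 0
∑< (suc n) f = f 0 + ∑< n (f ∘ suc)

∑<-last : ∀ n f → ∑< (suc n) f ≡ ∑< n f + f n
∑<-last zero    f = +-comm (f 0) 0
∑<-last (suc n) f = trans (cong (f 0 +_) (∑<-last n (f ∘ suc))) (sym (+-assoc (f 0) _ _))

∑<-cong : ∀ n {f g} → (∀ j → f j ≡ g j) → ∑< n f ≡ ∑< n g
∑<-cong zero    f≗g = refl
∑<-cong (suc n) f≗g = cong₂ _+_ (f≗g 0) (∑<-cong n (f≗g ∘ suc))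

∑<-+ : ∀ n f g → ∑< n (λ j → f j + g j) ≡ ∑< n f + ∑< n g
∑<-+ zero    f g = refl
∑<-+ (suc n) f g = trans (cong (f 0 + g 0 +_) (∑<-+ n (f ∘ suc) (g ∘ suc)))
                         (+-assoc-swap (f 0) (g 0) (∑< n (f ∘ suc)) (∑< n (g ∘ suc)))
  where
  +-assoc-swap : ∀ a b c d → a + b + (c + d) ≡ a + c + (b + d)
  +-assoc-swap = solve-∀

∑<-∣ : ∀ {d} n f → (∀ j → j < n → d ∣ f j) → d ∣ ∑< n f
∑<-∣ {d} zero f _ = d ∣0
∑<-∣ (suc n) f d∣f = ∣m∣n⇒∣m+n (d∣f 0 z<s) (∑<-∣ n (f ∘ suc) (λ j j<n → d∣f (suc j) (s<s j<n)))

vandermonde : ∀ m n r → (m + n) C (m + r) ≡ ∑< (suc m) (λ j → (m C j) * (n C (j + r)))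
vandermonde zero    n r = sym (trans (+-identityʳ _) (+-identityʳ (n C r)))
vandermonde (suc m) n r = begin
  suc (m + n) C suc (m + r)
    ≡⟨ nCk+nC[k+1]≡[n+1]C[k+1] (m + n) (m + r) ⟨
  (m + n) C (m + r) + (m + n) C suc (m + r)
    ≡⟨ cong₂ _+_ (vandermonde m n r)
                                                     (trans (cong ((m + n) C_) (sym (+-suc m r))) (vandermonde m n (suc r))) ⟩
  (1 * (n C r) + ∑< m g) + ∑< (suc m) h′
    ≡⟨ cong ((1 * (n C r) + ∑< m g) +_) (∑<-cong (suc m) (λ j → cong (λ i → (m C j) * (n C i)) (+-suc j r))) ⟩
  (1 * (n C r) + ∑< m g) + ∑< (suc m) h
    ≡⟨ rearrange (n C r) (∑< m g) (∑< (suc m) h) ⟩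
  1 * (n C r) + (∑< (suc m) h + (∑< m g + 0))
    ≡⟨ cong (λ x → 1 * (n C r) + (∑< (suc m) h + (∑< m g + x))) g[m]≡0 ⟨
  1 * (n C r) + (∑< (suc m) h + (∑< m g + g m))
    ≡⟨ cong (λ x → 1 * (n C r) + (∑< (suc m) h + x)) (∑<-last m g) ⟨
  1 * (n C r) + (∑< (suc m) h + ∑< (suc m) g)
    ≡⟨ cong (1 * (n C r) +_) (∑<-+ (suc m) h g) ⟨
  1 * (n C r) + ∑< (suc m) (λ j → h j + g j)
    ≡⟨ cong (1 * (n C r) +_) (∑<-cong (suc m) pascal) ⟩
  ∑< (suc (suc m)) (λ j → (suc m C j) * (n C (j + r))) ∎
  where
  open ≡-Reasoning
  g h h′ : ℕ → ℕ
  g j = (m C suc j) * (n C suc (j + r))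
  h j = (m C j) * (n C suc (j + r))
  h′ j = (m C j) * (n C (j + suc r))
  g[m]≡0 : g m ≡ 0
  g[m]≡0 = cong (_* (n C suc (m + r))) (k>n⇒nCk≡0 (n<1+n m))
  pascal : ∀ j → h j + g j ≡ (suc m C suc j) * (n C suc (j + r))
  pascal j = trans (sym (*-distribʳ-+ (n C suc (j + r)) (m C j) (m C suc j)))
                   (cong (_* (n C suc (j + r))) (nCk+nC[k+1]≡[n+1]C[k+1] m j))
  rearrange : ∀ a b c → (1 * a + b) + c ≡ 1 * a + (c + (b + 0))
  rearrange = solve-∀

C-absorb : ∀ n k → suc k * (suc n C suc k) ≡ suc n * (n C k)
C-absorb zero    zero    = refl
C-absorb zero    (suc k) = trans (cong (suc (suc k) *_) (k>n⇒nCk≡0 {1} (s<s (z<s {k})))) (*-zeroʳ (suc (suc k)))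
C-absorb (suc n) zero    = trans (+-identityʳ _) (trans (nC1≡n (suc (suc n))) (sym (*-identityʳ (suc (suc n)))))
C-absorb (suc n) (suc k) = begin
  suc (suc k) * (suc (suc n) C suc (suc k))
    ≡⟨ cong (suc (suc k) *_) (nCk+nC[k+1]≡[n+1]C[k+1] (suc n) (suc k)) ⟨
  suc (suc k) * (suc n C suc k + suc n C suc (suc k))
    ≡⟨ expand (suc k) (suc n C suc k) (suc n C suc (suc k)) ⟩
  suc k * (suc n C suc k) + suc n C suc k + suc (suc k) * (suc n C suc (suc k))
    ≡⟨ cong₂ (λ x y → x + suc n C suc k + y) (C-absorb n k) (C-absorb n (suc k)) ⟩
  suc n * (n C k) + suc n C suc k + suc n * (n C suc k)
    ≡⟨ collect (suc n) (n C k) (n C suc k) (suc n C suc k) ⟩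
  suc n * (n C k + n C suc k) + suc n C suc k
    ≡⟨ cong (λ x → suc n * x + suc n C suc k) (nCk+nC[k+1]≡[n+1]C[k+1] n k) ⟩
  suc n * (suc n C suc k) + suc n C suc k
    ≡⟨ +-comm (suc n * (suc n C suc k)) _ ⟩
  suc (suc n) * (suc n C suc k) ∎
  where
  open ≡-Reasoning
  expand : ∀ k x y → suc k * (x + y) ≡ k * x + x + suc k * y
  expand = solve-∀
  collect : ∀ n a b c → n * a + c + n * b ≡ n * (a + b) + c
  collect = solve-∀

∑<-ends : ∀ n .{{_ : NonZero n}} f → ∑< (suc n) f ≡ (f 0 + f n) + ∑< (pred n) (f ∘ suc)
∑<-ends (suc n) f = begin
  f 0 + ∑< (suc n) (f ∘ suc)             ≡⟨ cong (f 0 +_) (∑<-last n (f ∘ suc)) ⟩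
  f 0 + (∑< n (f ∘ suc) + f (suc n))     ≡⟨ swap (f 0) (∑< n (f ∘ suc)) (f (suc n)) ⟩
  (f 0 + f (suc n)) + ∑< n (f ∘ suc)     ∎
  where
  open ≡-Reasoning
  swap : ∀ a b c → a + (b + c) ≡ (a + c) + b
  swap = solve-∀

∑<-C≡2^ : ∀ n → ∑< (suc n) (n C_) ≡ 2 ^ n
∑<-C≡2^ zero    = refl
∑<-C≡2^ (suc n) = begin
  1 + ∑< (suc n) (λ j → suc n C suc j)
    ≡⟨ cong (1 +_) (∑<-cong (suc n) (λ j → nCk+nC[k+1]≡[n+1]C[k+1] n j)) ⟨
  1 + ∑< (suc n) (λ j → n C j + n C suc j)
    ≡⟨ cong (1 +_) (∑<-+ (suc n) (n C_) (λ j → n C suc j)) ⟩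
  1 + (∑< (suc n) (n C_) + ∑< (suc n) (λ j → n C suc j))
    ≡⟨ cong (λ x → 1 + (∑< (suc n) (n C_) + x)) (∑<-last n (λ j → n C suc j)) ⟩
  1 + (∑< (suc n) (n C_) + (∑< n (λ j → n C suc j) + n C suc n))
    ≡⟨ cong (λ x → 1 + (∑< (suc n) (n C_) + (∑< n (λ j → n C suc j) + x))) (k>n⇒nCk≡0 (n<1+n n)) ⟩
  1 + (∑< (suc n) (n C_) + (∑< n (λ j → n C suc j) + 0))
    ≡⟨ double (∑< n (λ j → n C suc j)) ⟩
  ∑< (suc n) (n C_) + (∑< (suc n) (n C_) + 0)
    ≡⟨ cong (λ x → x + (x + 0)) (∑<-C≡2^ n) ⟩
  2 ^ n + (2 ^ n + 0) ∎
  where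
  open ≡-Reasoning
  double : ∀ t → 1 + ((1 + t) + (t + 0)) ≡ (1 + t) + ((1 + t) + 0)
  double = solve-∀

C-factorial : ∀ m n → ((m + n) C m) * (m ! * n !) ≡ (m + n) !
C-factorial m n = begin
  ((m + n) C m) * (m ! * n !)
    ≡⟨ cong (λ k → ((m + n) C m) * (m ! * k !)) (m+n∸m≡n m n) ⟨
  ((m + n) C m) * (m ! * (m + n ∸ m) !)
    ≡⟨ cong (_* (m ! * (m + n ∸ m) !)) (nCk≡n!/k![n-k]! (m≤m+n m n)) ⟩
  ((m + n) ! / (m ! * (m + n ∸ m) !)) * (m ! * (m + n ∸ m) !)
    ≡⟨ m/n*n≡m (k![n∸k]!∣n! (m≤m+n m n)) ⟩
  (m + n) ! ∎
  where
  open ≡-Reasoning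
  instance _ = m !* (m + n ∸ m) !≢0

C-nonZero : ∀ m n → NonZero ((m + n) C m)
C-nonZero m n = ≢-nonZero λ C≡0 → ≢-nonZero⁻¹ ((m + n) !) {{(m + n) !≢0}}
  (trans (sym (C-factorial m n)) (cong (_* (m ! * n !)) C≡0))

trinomial : ℕ → ℕ → ℕ → ℕ
trinomial a b c = ((a + (b + c)) C a) * ((b + c) C b)

trinomial-factorial : ∀ a b c → trinomial a b c * (a ! * (b ! * c !)) ≡ (a + (b + c)) !
trinomial-factorial a b c = begin
  ((a + (b + c)) C a) * ((b + c) C b) * (a ! * (b ! * c !))
    ≡⟨ regroup ((a + (b + c)) C a) ((b + c) C b) (a !) (b ! * c !) ⟩
  ((a + (b + c)) C a) * (a ! * (((b + c) C b) * (b ! * c !)))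
    ≡⟨ cong (λ x → ((a + (b + c)) C a) * (a ! * x)) (C-factorial b c) ⟩
  ((a + (b + c)) C a) * (a ! * (b + c) !)
    ≡⟨ C-factorial a (b + c) ⟩
  (a + (b + c)) ! ∎
  where
  open ≡-Reasoning
  regroup : ∀ x y u v → x * y * (u * v) ≡ x * (u * (y * v))
  regroup = solve-∀

trinomial-shift : ∀ a b c → let s = a + (b + c) in
  trinomial a b c * ((1 + s) * (2 + s) * (3 + s) * (4 + s) * (5 + s) * (6 + s))
    ≡ trinomial (3 + a) (2 + b) (1 + c) * ((1 + a) * (2 + a) * (3 + a) * ((1 + b) * (2 + b)) * (1 + c))
trinomial-shift a b c = *-cancelʳ-≡ _ _ (a ! * (b ! * c !)) (begin
  t * R * G                                  ≡⟨ lhs-regroup t R G ⟩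
  t * G * R                                  ≡⟨ cong (_* R) (trinomial-factorial a b c) ⟩
  s ! * R                                    ≡⟨ rising s (s !) ⟩
  (6 + s) !                                  ≡⟨ cong _! (shift-sum a b c) ⟩
  ((3 + a) + ((2 + b) + (1 + c))) !          ≡⟨ trinomial-factorial (3 + a) (2 + b) (1 + c) ⟨
  t′ * ((3 + a) ! * ((2 + b) ! * (1 + c) !)) ≡⟨ rhs-regroup a b c t′ (a !) (b !) (c !) ⟩
  t′ * Q * G                                 ∎)
  where
  open ≡-Reasoning
  instance _ = m*n≢0 (a !) (b ! * c !) {{a !≢0}} {{b !* c !≢0}}
  s = a + (b + c)
  t = trinomial a b c
  t′ = trinomial (3 + a) (2 + b) (1 + c)
  R = (1 + s) * (2 + s) * (3 + s) * (4 + s) * (5 + s) * (6 + s)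
  Q = (1 + a) * (2 + a) * (3 + a) * ((1 + b) * (2 + b)) * (1 + c)
  G = a ! * (b ! * c !)
  lhs-regroup : ∀ x y z → x * y * z ≡ x * z * y
  lhs-regroup = solve-∀
  rising : ∀ s f → f * ((1 + s) * (2 + s) * (3 + s) * (4 + s) * (5 + s) * (6 + s))
                 ≡ (6 + s) * ((5 + s) * ((4 + s) * ((3 + s) * ((2 + s) * ((1 + s) * f)))))
  rising = solve-∀
  shift-sum : ∀ a b c → 6 + (a + (b + c)) ≡ (3 + a) + ((2 + b) + (1 + c))
  shift-sum = solve-∀
  rhs-regroup : ∀ a b c x fa fb fc →
    x * ((3 + a) * ((2 + a) * ((1 + a) * fa)) * ((2 + b) * ((1 + b) * fb) * ((1 + c) * fc)))
      ≡ x * ((1 + a) * (2 + a) * (3 + a) * ((1 + b) * (2 + b)) * (1 + c)) * (fa * (fb * fc))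
  rhs-regroup = solve-∀

<⇒∤ : ∀ {p x} → 0 < x → x < p → p ∤ x
<⇒∤ {x = suc _} _ x<p p∣x = <⇒≱ x<p (∣⇒≤ p∣x)

+<⇒∤ : ∀ {p x i} k → 0 < i → i < p → x + i ≡ k * p → p ∤ x
+<⇒∤ {p} k 0<i i<p x+i≡kp p∣x = <⇒∤ 0<i i<p (∣m+n∣m⇒∣n (subst (p ∣_) (sym x+i≡kp) (n∣m*n k)) p∣x)

module _ {p : ℕ} (p-prime : Prime p) where

  private instance
    p≢0 : NonZero p
    p≢0 = prime⇒nonZero p-prime
    p²≢0 : NonZero (p * p)
    p²≢0 = m*n≢0 p p

  p∣C : ∀ {m k} → p ∣ m → p ∤ k → p ∣ m C k
  p∣C {_}     {zero}  _   p∤k = contradiction (p ∣0) p∤k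
  p∣C {zero}  {suc k} _   _   = p ∣0
  p∣C {suc m} {suc k} p∣m p∤k
    with euclidsLemma (suc k) (suc m C suc k) p-prime (subst (p ∣_) (sym (C-absorb m k)) (∣m⇒∣m*n (m C k) p∣m))
  ... | inj₁ p∣k = contradiction p∣k p∤k
  ... | inj₂ p∣C = p∣C

  p∤1+j : ∀ {j} → j < pred p → p ∤ suc j
  p∤1+j j<p-1 = <⇒∤ z<s (subst (_ <_) (suc-pred p) (s≤s j<p-1))

  vandermonde-by-p : ∀ a b → (p + a * p) C (p + b * p)
                    ≡ (a * p) C (b * p) + (a * p) C (suc b * p) + ∑< (pred p) (λ j → (p C suc j) * ((a * p) C (suc j + b * p)))
  vandermonde-by-p a b = begin
    (p + a * p) C (p + b * p)
      ≡⟨ vandermonde p (a * p) (b * p) ⟩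
    ∑< (suc p) term
      ≡⟨ ∑<-ends p term ⟩
    term 0 + term p + M
      ≡⟨ cong (λ x → term 0 + x * ((a * p) C (p + b * p)) + M) (nCn≡1 p) ⟩
    1 * ((a * p) C (b * p)) + 1 * ((a * p) C (p + b * p)) + M
      ≡⟨ cong₂ (λ x y → x + y + M) (*-identityˡ ((a * p) C (b * p))) (*-identityˡ ((a * p) C (p + b * p))) ⟩
    (a * p) C (b * p) + (a * p) C (suc b * p) + M ∎
    where
    open ≡-Reasoning
    term : ℕ → ℕ
    term j = (p C j) * ((a * p) C (j + b * p))
    M = ∑< (pred p) (term ∘ suc)

  babbage : ∀ a b → (a * p) C (b * p) ≡ a C b [mod p * p ]
  babbage a       zero    = mod-≡ refl
  babbage zero    (suc b) = mod-≡ (cong (_% (p * p)) (k>n⇒nCk≡0 (≤-trans (>-nonZero⁻¹ p) (m≤m+n p (b * p)))))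
  babbage (suc a) (suc b) = begin
    (p + a * p) C (p + b * p)
      ≡⟨ vandermonde-by-p a b ⟩
    (a * p) C (b * p) + (a * p) C (suc b * p) + M
      ≈⟨ +-∣-modʳ _ (∑<-∣ (pred p) _ p²∣middle) ⟩
    (a * p) C (b * p) + (a * p) C (suc b * p)
      ≈⟨ +-cong-mod (babbage a b) (babbage a (suc b)) ⟩
    a C b + a C suc b
      ≡⟨ nCk+nC[k+1]≡[n+1]C[k+1] a b ⟩
    suc a C suc b ∎
    where
    open SetoidReasoning (≡-mod-setoid (p * p))
    M = ∑< (pred p) (λ j → (p C suc j) * ((a * p) C (suc j + b * p)))
    p²∣middle : ∀ j → j < pred p → p * p ∣ (p C suc j) * ((a * p) C (suc j + b * p))
    p²∣middle j j<p-1 = *-pres-∣ (p∣C ∣-refl (p∤1+j j<p-1)) (p∣C (n∣m*n a) p∤1+j+bp)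
      where
      p∤1+j+bp : p ∤ suc j + b * p
      p∤1+j+bp p∣ = p∤1+j j<p-1 (∣m+n∣m⇒∣n (subst (p ∣_) (+-comm (suc j) (b * p)) p∣) (n∣m*n b))

  fermat₂ : 2 < p → ∃ λ q → 2 ^ pred p ≡ 1 + q * p
  fermat₂ 2<p = quotient p∣e , trans (sym 1+e≡2^[p-1]) (cong suc (_∣_.equality p∣e))
    where
    open ≡-Reasoning
    e = 2 ^ pred p ∸ 1
    1+e≡2^[p-1] : 1 + e ≡ 2 ^ pred p
    1+e≡2^[p-1] = m+[n∸m]≡n (m^n>0 2 (pred p))
    M = ∑< (pred p) (λ j → p C suc j)
    2+2e≡2+M : 2 + 2 * e ≡ 2 + M
    2+2e≡2+M = begin
      2 + 2 * e                 ≡⟨ *-distribˡ-+ 2 1 e ⟨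
      2 * (1 + e)               ≡⟨ cong (2 *_) 1+e≡2^[p-1] ⟩
      2 ^ suc (pred p)          ≡⟨ cong (2 ^_) (suc-pred p) ⟩
      2 ^ p                     ≡⟨ ∑<-C≡2^ p ⟨
      ∑< (suc p) (p C_)         ≡⟨ ∑<-ends p (p C_) ⟩
      (1 + p C p) + M           ≡⟨ cong (λ x → 1 + x + M) (nCn≡1 p) ⟩
      2 + M                     ∎
    p∣2e : p ∣ 2 * e
    p∣2e = subst (p ∣_) (sym (+-cancelˡ-≡ 2 _ _ 2+2e≡2+M))
             (∑<-∣ (pred p) _ (λ j j<p-1 → p∣C ∣-refl (p∤1+j j<p-1)))
    p∣e : p ∣ e
    p∣e = [ (λ p∣2 → contradiction p∣2 (<⇒∤ z<s 2<p)) , (λ p∣e → p∣e) ]′ (euclidsLemma 2 e p-prime p∣2e)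

  trinomial-mod : ∀ a b c → trinomial (a * p) (b * p) (c * p) ≡ trinomial a b c [mod p * p ]
  trinomial-mod a b c = begin
    ((a * p + (b * p + c * p)) C (a * p)) * ((b * p + c * p) C (b * p))
      ≡⟨ cong₂ (λ x y → (x C (a * p)) * (y C (b * p))) a+b+c≡ (sym (*-distribʳ-+ p b c)) ⟩
    (((a + (b + c)) * p) C (a * p)) * (((b + c) * p) C (b * p))
      ≈⟨ *-cong-mod (babbage (a + (b + c)) a) (babbage (b + c) b) ⟩
    ((a + (b + c)) C a) * ((b + c) C b) ∎
    where
    open SetoidReasoning (≡-mod-setoid (p * p))
    a+b+c≡ : a * p + (b * p + c * p) ≡ (a + (b + c)) * p
    a+b+c≡ = trans (cong (a * p +_) (sym (*-distribʳ-+ p b c))) (sym (*-distribʳ-+ p a (b + c)))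

  ∤-* : ∀ {a b} → p ∤ a → p ∤ b → p ∤ a * b
  ∤-* p∤a p∤b p∣ab = [ p∤a , p∤b ]′ (euclidsLemma _ _ p-prime p∣ab)

  ∤-^ : ∀ {m} → p ∤ m → ∀ k → p ∤ m ^ k
  ∤-^ p∤m zero    = <⇒∤ z<s (nonTrivial⇒n>1 p {{prime⇒nonTrivial p-prime}})
  ∤-^ p∤m (suc k) = ∤-* p∤m (∤-^ p∤m k)

  ∤⇒^∣*-cancelˡ : ∀ {m} → p ∤ m → ∀ k {x} → p ^ k ∣ m * x → p ^ k ∣ x
  ∤⇒^∣*-cancelˡ p∤m zero    {x} _ = 1∣ x
  ∤⇒^∣*-cancelˡ {m} p∤m (suc k) {x} p^[1+k]∣mx
    with euclidsLemma m x p-prime (∣-trans (m∣m*n (p ^ k)) p^[1+k]∣mx)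
  ... | inj₁ p∣m = contradiction p∣m p∤m
  ... | inj₂ (divides y refl) = subst (_∣ y * p) (*-comm (p ^ k) p) (*-monoˡ-∣ p p^k∣y)
    where
    p^k*p∣m*y*p : p ^ k * p ∣ m * y * p
    p^k*p∣m*y*p = subst₂ _∣_ (*-comm p (p ^ k)) (sym (*-assoc m y p)) p^[1+k]∣mx
    p^k∣y : p ^ k ∣ y
    p^k∣y = ∤⇒^∣*-cancelˡ p∤m k (*-cancelʳ-∣ p p^k*p∣m*y*p)

diagonalTrinomial : ℕ → ℕ
diagonalTrinomial n = trinomial (2 * n + n) (2 * n) n

module _ {n : ℕ} (p-prime : Prime (suc n)) where

  private
    p = suc n
    t = diagonalTrinomial n
    t′ = trinomial (3 * p) (2 * p) (1 * p)

  diagonal-shift : t * ((1 + 6 * n) * (2 + 6 * n) * (3 + 6 * n) * (4 + 6 * n) * (5 + 6 * n))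
                     ≡ t′ * (p * p * ((1 + 3 * n) * (2 + 3 * n) * (1 + 2 * n)))
  diagonal-shift = *-cancelʳ-≡ _ _ (6 * p) (begin
    t * E5 * (6 * p)   ≡⟨ E5*6p≡R n t ⟩
    t * R              ≡⟨ trinomial-shift (2 * n + n) (2 * n) n ⟩
    t″ * Q             ≡⟨ cong (_* Q) t″≡t′ ⟩
    t′ * Q             ≡⟨ Q≡p²W*6p n t′ ⟩
    t′ * (p * p * W) * (6 * p) ∎)
    where
    open ≡-Reasoning
    s = (2 * n + n) + (2 * n + n)
    E5 = (1 + 6 * n) * (2 + 6 * n) * (3 + 6 * n) * (4 + 6 * n) * (5 + 6 * n)
    W = (1 + 3 * n) * (2 + 3 * n) * (1 + 2 * n)
    R = (1 + s) * (2 + s) * (3 + s) * (4 + s) * (5 + s) * (6 + s)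
    Q = (1 + (2 * n + n)) * (2 + (2 * n + n)) * (3 + (2 * n + n)) * ((1 + 2 * n) * (2 + 2 * n)) * (1 + n)
    t″ = trinomial (3 + (2 * n + n)) (2 + 2 * n) (1 + n)
    t″≡t′ : t″ ≡ t′
    t″≡t′ = cong₃ trinomial (3+3n n) (2+2n n) (1+n n)
      where
      cong₃ : ∀ (f : ℕ → ℕ → ℕ → ℕ) {a a′ b b′ c c′} → a ≡ a′ → b ≡ b′ → c ≡ c′ → f a b c ≡ f a′ b′ c′
      cong₃ f refl refl refl = refl
      3+3n : ∀ n → 3 + (2 * n + n) ≡ 3 * suc n
      3+3n = solve-∀
      2+2n : ∀ n → 2 + 2 * n ≡ 2 * suc n
      2+2n = solve-∀
      1+n : ∀ n → 1 + n ≡ 1 * suc n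
      1+n = solve-∀
    E5*6p≡R : ∀ n t → t * ((1 + 6 * n) * (2 + 6 * n) * (3 + 6 * n) * (4 + 6 * n) * (5 + 6 * n)) * (6 * suc n)
                    ≡ t * ((1 + ((2 * n + n) + (2 * n + n))) * (2 + ((2 * n + n) + (2 * n + n))) * (3 + ((2 * n + n) + (2 * n + n)))
                           * (4 + ((2 * n + n) + (2 * n + n))) * (5 + ((2 * n + n) + (2 * n + n))) * (6 + ((2 * n + n) + (2 * n + n))))
    E5*6p≡R = solve-∀
    Q≡p²W*6p : ∀ n t → t * ((1 + (2 * n + n)) * (2 + (2 * n + n)) * (3 + (2 * n + n)) * ((1 + 2 * n) * (2 + 2 * n)) * (1 + n))
                    ≡ t * (suc n * suc n * ((1 + 3 * n) * (2 + 3 * n) * (1 + 2 * n))) * (6 * suc n)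
    Q≡p²W*6p = solve-∀

  p∤4·[6n+1]⋯[6n+5] : 5 < p → p ∤ 4 * ((1 + 6 * n) * (2 + 6 * n) * (3 + 6 * n) * (4 + 6 * n) * (5 + 6 * n))
  p∤4·[6n+1]⋯[6n+5] 5<p =
    ∤-* p-prime (<⇒∤ z<s (<-trans (n<1+n 4) 5<p))
      (∤-* p-prime (∤-* p-prime (∤-* p-prime (∤-* p-prime (p∤[1+j+6n] 0 5 refl z<s) (p∤[1+j+6n] 1 4 refl z<s))
        (p∤[1+j+6n] 2 3 refl z<s)) (p∤[1+j+6n] 3 2 refl z<s)) (p∤[1+j+6n] 4 1 refl z<s))
    where
    p∤[1+j+6n] : ∀ j i → suc j + i ≡ 6 → 0 < i → p ∤ suc j + 6 * n
    p∤[1+j+6n] j i 1+j+i≡6 0<i = +<⇒∤ 6 0<i i<p (trans (rearrange (suc j) i n) (trans (cong (_+ 6 * n) 1+j+i≡6) (6+6n≡6p n)))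
      where
      i<p : i < p
      i<p = ≤-<-trans (subst (i ≤_) (suc-injective 1+j+i≡6) (m≤n+m i j)) 5<p
      rearrange : ∀ a b n → a + 6 * n + b ≡ a + b + 6 * n
      rearrange = solve-∀
      6+6n≡6p : ∀ n → 6 + 6 * n ≡ 6 * suc n
      6+6n≡6p = solve-∀

  diagonal-core : 5 < p → p ^ 4 ∣ (18 * n + 3) * t + 15 * p ^ 2 * (1 + 6 * p)
  diagonal-core 5<p = ∤⇒^∣*-cancelˡ p-prime (p∤4·[6n+1]⋯[6n+5] 5<p) 4 (≡0-mod⇒∣ (begin
    4 * E5 * X                ≡⟨ expand ⟩
    t′ * K + L                ≈⟨ +-cong-mod (*-congʳ-mod K p⁴∣p²K (trinomial-mod p-prime 3 2 1)) (mod-≡ {L} refl) ⟩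
    60 * K + L                ≡⟨ collapse n ⟩
    2160 * E4 * p ^ 4         ≈⟨ mod-≡ (m*n%n≡0 (2160 * E4) (p ^ 4)) ⟩
    0                         ∎))
    where
    open SetoidReasoning (≡-mod-setoid (p ^ 4))
    E4 = (1 + 6 * n) * (2 + 6 * n) * (3 + 6 * n) * (4 + 6 * n)
    E5 = E4 * (5 + 6 * n)
    W = (1 + 3 * n) * (2 + 3 * n) * (1 + 2 * n)
    X = (18 * n + 3) * t + 15 * p ^ 2 * (1 + 6 * p)
    K = 4 * (18 * n + 3) * (p * p * W)
    L = 60 * p ^ 2 * (1 + 6 * p) * E5
    expand : 4 * E5 * X ≡ t′ * K + L
    expand = trans (distribute n t) (cong (_+ L) (trans (cong (4 * (18 * n + 3) *_) diagonal-shift)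
                                                 (x*[y*z]≡y*[x*z] (4 * (18 * n + 3)) t′ (p * p * W))))
      where
      distribute : ∀ n t → 4 * ((1 + 6 * n) * (2 + 6 * n) * (3 + 6 * n) * (4 + 6 * n) * (5 + 6 * n))
                             * ((18 * n + 3) * t + 15 * (suc n * (suc n * 1)) * (1 + 6 * suc n))
                         ≡ 4 * (18 * n + 3) * (t * ((1 + 6 * n) * (2 + 6 * n) * (3 + 6 * n) * (4 + 6 * n) * (5 + 6 * n)))
                             + 60 * (suc n * (suc n * 1)) * (1 + 6 * suc n) * ((1 + 6 * n) * (2 + 6 * n) * (3 + 6 * n) * (4 + 6 * n) * (5 + 6 * n))
      distribute = solve-∀
      x*[y*z]≡y*[x*z] : ∀ x y z → x * (y * z) ≡ y * (x * z)
      x*[y*z]≡y*[x*z] = solve-∀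
    p⁴∣p²K : p ^ 4 ∣ p * p * K
    p⁴∣p²K = divides (4 * (18 * n + 3) * W) (regroup p (4 * (18 * n + 3)) W)
      where
      regroup : ∀ p c w → p * p * (c * (p * p * w)) ≡ c * w * (p * (p * (p * (p * 1))))
      regroup = solve-∀
    -- (6p - 1)(6p + 1) + 1 = 36p² is what makes this a multiple of p⁴.
    collapse : ∀ n → 60 * (4 * (18 * n + 3) * (suc n * suc n * ((1 + 3 * n) * (2 + 3 * n) * (1 + 2 * n))))
                       + 60 * (suc n * (suc n * 1)) * (1 + 6 * suc n) * ((1 + 6 * n) * (2 + 6 * n) * (3 + 6 * n) * (4 + 6 * n) * (5 + 6 * n))
                   ≡ 2160 * ((1 + 6 * n) * (2 + 6 * n) * (3 + 6 * n) * (4 + 6 * n)) * (suc n * (suc n * (suc n * (suc n * 1))))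
    collapse = solve-∀

diagonal-congruence : ∀ n → Prime (suc n) → 3 < suc n →
  suc n ^ 4 ∣ (18 * n + 3) * diagonalTrinomial n + 15 * suc n ^ 2 * (1 + 6 * suc n)
diagonal-congruence 1 _ (s≤s (s≤s ()))
diagonal-congruence 2 _ (s≤s (s≤s (s≤s ())))
diagonal-congruence 3 p-prime _ = contradiction p-prime (composite⇒¬prime composite[4])
-- 5 divides the factor 6p - 5 cancelled in diagonal-core, so p = 5 is checked directly.
diagonal-congruence 4 _     _ = divides 160626885 refl
diagonal-congruence (suc (suc (suc (suc (suc _))))) p-prime _ =
  diagonal-core p-prime (s≤s (s≤s (s≤s (s≤s (s≤s (s≤s z≤n))))))

frac-cancelʳ : ∀ a d c .{{_ : NonZero d}} .{{_ : NonZero c}} → frac (a ℤ.* ℤ.+ c) (d * c) ≡ frac a d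
frac-cancelʳ a d c = frac-≡ {a ℤ.* ℤ.+ c} {c = a} {{m*n≢0 d c}} (begin
  a ℤ.* ℤ.+ c ℤ.* ℤ.+ d        ≡⟨ ℤ.*-assoc a (ℤ.+ c) (ℤ.+ d) ⟩
  a ℤ.* (ℤ.+ c ℤ.* ℤ.+ d)      ≡⟨ cong (a ℤ.*_) (ℤ.*-comm (ℤ.+ c) (ℤ.+ d)) ⟩
  a ℤ.* (ℤ.+ d ℤ.* ℤ.+ c)      ≡⟨ cong (a ℤ.*_) (ℤ.pos-* d c) ⟨
  a ℤ.* ℤ.+ (d * c)            ∎)
  where open ≡-Reasoning

sgn-double : ∀ n → sgn (n + n) ≡ ℤ.+ 1
sgn-double zero    = refl
sgn-double (suc n) = trans (cong (sgn ∘ suc) (+-suc n n)) (sgn-double n)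

F-diagonal : ∀ n → F n n ≡ frac (ℤ.+ ((18 * n + 3) * diagonalTrinomial n)) (4 ^ (4 * n))
F-diagonal n = begin
  F n n                                             ≡⟨ cong₂ frac numerator denominator ⟩
  frac (ℤ.+ N ℤ.* ℤ.+ c) (4 ^ (4 * n) * c)           ≡⟨ frac-cancelʳ (ℤ.+ N) (4 ^ (4 * n)) c {{m^n≢0 4 (4 * n)}} {{c≢0}} ⟩
  frac (ℤ.+ N) (4 ^ (4 * n))                        ∎
  where
  open ≡-Reasoning
  c = (2 * n) C n
  t = diagonalTrinomial n
  N = (18 * n + 3) * t
  c≢0 : NonZero c
  c≢0 = subst (λ m → NonZero (m C n)) (cong (n +_) (sym (+-identityʳ n))) (C-nonZero n n)
  [2n∸n]Cn≡1 : (2 * n ∸ n) C n ≡ 1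
  [2n∸n]Cn≡1 = trans (cong (_C n) (trans (m+n∸m≡n n (n + 0)) (+-identityʳ n))) (nCn≡1 n)
  products : c * ((4 * n + 2 * n) C (2 * n + n)) * ((2 * n ∸ n) C n) * ((2 * n + n) C (2 * n)) ≡ c * t
  products = trans (cong₂ (λ x y → c * (x C (2 * n + n)) * y * ((2 * n + n) C (2 * n))) (4n+2n≡3n+3n n) [2n∸n]Cn≡1)
                   (*-identityʳ-middle c (((2 * n + n) + (2 * n + n)) C (2 * n + n)) ((2 * n + n) C (2 * n)))
    where
    4n+2n≡3n+3n : ∀ n → 4 * n + 2 * n ≡ (2 * n + n) + (2 * n + n)
    4n+2n≡3n+3n = solve-∀
    *-identityʳ-middle : ∀ x y z → x * y * 1 * z ≡ x * (y * z)
    *-identityʳ-middle = solve-∀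
  18n+3 : (ℤ.+ (20 * n) ℤ.- ℤ.+ (2 * n)) ℤ.+ ℤ.+ 3 ≡ ℤ.+ (18 * n + 3)
  18n+3 = trans (cong (λ x → (ℤ.+ x ℤ.- ℤ.+ (2 * n)) ℤ.+ ℤ.+ 3) (20n≡18n+2n n)) (x+y-y+3≡x+3 (ℤ.+ (18 * n)) (ℤ.+ (2 * n)))
    where
    20n≡18n+2n : ∀ n → 20 * n ≡ 18 * n + 2 * n
    20n≡18n+2n = solve-∀
    x+y-y+3≡x+3 : ∀ x y → (x ℤ.+ y ℤ.- y) ℤ.+ ℤ.+ 3 ≡ x ℤ.+ ℤ.+ 3
    x+y-y+3≡x+3 = ℤ-Solver.solve-∀
  numerator : sgn (n + n) ℤ.* ((ℤ.+ (20 * n) ℤ.- ℤ.+ (2 * n)) ℤ.+ ℤ.+ 3)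
                ℤ.* ℤ.+ (c * ((4 * n + 2 * n) C (2 * n + n)) * ((2 * n ∸ n) C n) * ((2 * n + n) C (2 * n)))
              ≡ ℤ.+ N ℤ.* ℤ.+ c
  numerator = begin
    sgn (n + n) ℤ.* ((ℤ.+ (20 * n) ℤ.- ℤ.+ (2 * n)) ℤ.+ ℤ.+ 3) ℤ.* ℤ.+ P
      ≡⟨ cong₂ (λ s x → s ℤ.* x ℤ.* ℤ.+ P) (sgn-double n) 18n+3 ⟩
    ℤ.+ 1 ℤ.* ℤ.+ (18 * n + 3) ℤ.* ℤ.+ P
      ≡⟨ cong (ℤ._* ℤ.+ P) (ℤ.*-identityˡ (ℤ.+ (18 * n + 3))) ⟩
    ℤ.+ (18 * n + 3) ℤ.* ℤ.+ P
      ≡⟨ ℤ.pos-* (18 * n + 3) P ⟨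
    ℤ.+ ((18 * n + 3) * P)
      ≡⟨ cong (λ x → ℤ.+ ((18 * n + 3) * x)) products ⟩
    ℤ.+ ((18 * n + 3) * (c * t))
      ≡⟨ cong ℤ.+_ (x*[y*z]≡x*z*y (18 * n + 3) c t) ⟩
    ℤ.+ (N * c)
      ≡⟨ ℤ.pos-* N c ⟩
    ℤ.+ N ℤ.* ℤ.+ c ∎
    where
    P = c * ((4 * n + 2 * n) C (2 * n + n)) * ((2 * n ∸ n) C n) * ((2 * n + n) C (2 * n))
    x*[y*z]≡x*z*y : ∀ x y z → x * (y * z) ≡ x * z * y
    x*[y*z]≡x*z*y = solve-∀
  denominator : 4 ^ (5 * n ∸ n) * c ≡ 4 ^ (4 * n) * c
  denominator = cong (λ k → 4 ^ k * c) (m+n∸m≡n n (4 * n))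

frac₁-+ : ∀ a b → frac a 1 ℚ.+ frac b 1 ≡ frac (a ℤ.+ b) 1
frac₁-+ a b = trans (frac-+ a 1 b 1) (cong₂ (λ x y → frac (x ℤ.+ y) 1) (ℤ.*-identityʳ a) (ℤ.*-identityʳ b))

frac₁-* : ∀ a b → frac a 1 ℚ.* frac b 1 ≡ frac (a ℤ.* b) 1
frac₁-* a b = frac-* a 1 b 1

8p*fermatQuotient2 : ∀ n → let p = suc n in
  frac (ℤ.+ (8 * p)) 1 ℚ.* fermatQuotient2 p ≡ frac (ℤ.+ 8 ℤ.* (ℤ.+ (2 ^ n) ℤ.- ℤ.+ 1)) 1
8p*fermatQuotient2 n = trans (frac-* (ℤ.+ (8 * p)) 1 V p) (frac-≡ {ℤ.+ (8 * p) ℤ.* V} {c = ℤ.+ 8 ℤ.* V} (begin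
  ℤ.+ (8 * p) ℤ.* V ℤ.* ℤ.+ 1         ≡⟨ cong (λ x → x ℤ.* V ℤ.* ℤ.+ 1) (ℤ.pos-* 8 p) ⟩
  ℤ.+ 8 ℤ.* ℤ.+ p ℤ.* V ℤ.* ℤ.+ 1     ≡⟨ regroup (ℤ.+ 8) (ℤ.+ p) V ⟩
  ℤ.+ 8 ℤ.* V ℤ.* ℤ.+ p               ≡⟨ cong (λ x → ℤ.+ 8 ℤ.* V ℤ.* ℤ.+ x) (*-identityˡ p) ⟨
  ℤ.+ 8 ℤ.* V ℤ.* ℤ.+ (1 * p)         ∎))
  where
  open ≡-Reasoning
  p = suc n
  V = ℤ.+ (2 ^ n) ℤ.- ℤ.+ 1
  regroup : ∀ e p v → e ℤ.* p ℤ.* v ℤ.* ℤ.+ 1 ≡ e ℤ.* v ℤ.* p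
  regroup = ℤ-Solver.solve-∀

rhs-integral : ∀ n → let p = suc n in
  frac (ℤ.+ (15 * p ^ 2)) 1 ℚ.* ((ℚ.- frac (ℤ.+ 1) 1 ℚ.- frac (ℤ.+ (6 * p)) 1) ℚ.+ frac (ℤ.+ (8 * p)) 1 ℚ.* fermatQuotient2 p)
    ≡ frac (ℤ.+ (15 * p ^ 2 * (8 * 2 ^ n)) ℤ.- ℤ.+ (15 * p ^ 2 * (9 + 6 * p))) 1
rhs-integral n = begin
  frac S 1 ℚ.* ((ℚ.- frac (ℤ.+ 1) 1 ℚ.- frac (ℤ.+ (6 * p)) 1) ℚ.+ frac (ℤ.+ (8 * p)) 1 ℚ.* fermatQuotient2 p)
    ≡⟨ cong (λ x → frac S 1 ℚ.* ((ℚ.- frac (ℤ.+ 1) 1 ℚ.- frac (ℤ.+ (6 * p)) 1) ℚ.+ x)) (8p*fermatQuotient2 n) ⟩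
  frac S 1 ℚ.* ((ℚ.- frac (ℤ.+ 1) 1 ℚ.- frac (ℤ.+ (6 * p)) 1) ℚ.+ frac (ℤ.+ 8 ℤ.* V) 1)
    ≡⟨ cong₂ (λ x y → frac S 1 ℚ.* ((x ℚ.+ y) ℚ.+ frac (ℤ.+ 8 ℤ.* V) 1)) (frac-neg (ℤ.+ 1) 1) (frac-neg (ℤ.+ (6 * p)) 1) ⟩
  frac S 1 ℚ.* ((frac (ℤ.- ℤ.+ 1) 1 ℚ.+ frac (ℤ.- ℤ.+ (6 * p)) 1) ℚ.+ frac (ℤ.+ 8 ℤ.* V) 1)
    ≡⟨ cong (λ x → frac S 1 ℚ.* (x ℚ.+ frac (ℤ.+ 8 ℤ.* V) 1)) (frac₁-+ (ℤ.- ℤ.+ 1) (ℤ.- ℤ.+ (6 * p))) ⟩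
  frac S 1 ℚ.* (frac (ℤ.- ℤ.+ 1 ℤ.+ ℤ.- ℤ.+ (6 * p)) 1 ℚ.+ frac (ℤ.+ 8 ℤ.* V) 1)
    ≡⟨ cong (frac S 1 ℚ.*_) (frac₁-+ (ℤ.- ℤ.+ 1 ℤ.+ ℤ.- ℤ.+ (6 * p)) (ℤ.+ 8 ℤ.* V)) ⟩
  frac S 1 ℚ.* frac (ℤ.- ℤ.+ 1 ℤ.+ ℤ.- ℤ.+ (6 * p) ℤ.+ ℤ.+ 8 ℤ.* V) 1
    ≡⟨ frac₁-* S (ℤ.- ℤ.+ 1 ℤ.+ ℤ.- ℤ.+ (6 * p) ℤ.+ ℤ.+ 8 ℤ.* V) ⟩
  frac (S ℤ.* (ℤ.- ℤ.+ 1 ℤ.+ ℤ.- ℤ.+ (6 * p) ℤ.+ ℤ.+ 8 ℤ.* V)) 1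
    ≡⟨ cong (λ x → frac x 1) integer-identity ⟩
  frac (ℤ.+ (15 * p ^ 2 * (8 * 2 ^ n)) ℤ.- ℤ.+ (15 * p ^ 2 * (9 + 6 * p))) 1 ∎
  where
  open ≡-Reasoning
  p = suc n
  S = ℤ.+ (15 * p ^ 2)
  U = ℤ.+ (2 ^ n)
  V = U ℤ.- ℤ.+ 1
  integer-identity : S ℤ.* (ℤ.- ℤ.+ 1 ℤ.+ ℤ.- ℤ.+ (6 * p) ℤ.+ ℤ.+ 8 ℤ.* V)
                       ≡ ℤ.+ (15 * p ^ 2 * (8 * 2 ^ n)) ℤ.- ℤ.+ (15 * p ^ 2 * (9 + 6 * p))
  integer-identity = begin
    S ℤ.* (ℤ.- ℤ.+ 1 ℤ.+ ℤ.- ℤ.+ (6 * p) ℤ.+ ℤ.+ 8 ℤ.* V)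
      ≡⟨ cong (λ x → S ℤ.* (ℤ.- ℤ.+ 1 ℤ.+ ℤ.- x ℤ.+ ℤ.+ 8 ℤ.* V)) (ℤ.pos-* 6 p) ⟩
    S ℤ.* (ℤ.- ℤ.+ 1 ℤ.+ ℤ.- (ℤ.+ 6 ℤ.* ℤ.+ p) ℤ.+ ℤ.+ 8 ℤ.* V)
      ≡⟨ expand S (ℤ.+ p) U ⟩
    S ℤ.* (ℤ.+ 8 ℤ.* U) ℤ.- S ℤ.* (ℤ.+ 9 ℤ.+ ℤ.+ 6 ℤ.* ℤ.+ p)
      ≡⟨ cong₂ (λ x y → S ℤ.* x ℤ.- S ℤ.* (ℤ.+ 9 ℤ.+ y)) (ℤ.pos-* 8 (2 ^ n)) (ℤ.pos-* 6 p) ⟨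
    S ℤ.* ℤ.+ (8 * 2 ^ n) ℤ.- S ℤ.* ℤ.+ (9 + 6 * p)
      ≡⟨ cong₂ ℤ._-_ (ℤ.pos-* (15 * p ^ 2) (8 * 2 ^ n)) (ℤ.pos-* (15 * p ^ 2) (9 + 6 * p)) ⟨
    ℤ.+ (15 * p ^ 2 * (8 * 2 ^ n)) ℤ.- ℤ.+ (15 * p ^ 2 * (9 + 6 * p)) ∎
    where
    expand : ∀ s P U → s ℤ.* (ℤ.- ℤ.+ 1 ℤ.+ ℤ.- (ℤ.+ 6 ℤ.* P) ℤ.+ ℤ.+ 8 ℤ.* (U ℤ.- ℤ.+ 1))
                         ≡ s ℤ.* (ℤ.+ 8 ℤ.* U) ℤ.- s ℤ.* (ℤ.+ 9 ℤ.+ ℤ.+ 6 ℤ.* P)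
    expand = ℤ-Solver.solve-∀

module _ {n : ℕ} (p-prime : Prime (suc n)) (3<p : 3 < suc n) where

  private
    p = suc n
    N = (18 * n + 3) * diagonalTrinomial n
    T = 4 ^ (4 * n)
    Ra = 15 * p ^ 2 * (8 * 2 ^ n)
    Rb = 15 * p ^ 2 * (9 + 6 * p)
    q = proj₁ (fermat₂ p-prime (<-trans (n<1+n 2) 3<p))
    2^n≡1+qp : 2 ^ n ≡ 1 + q * p
    2^n≡1+qp = proj₂ (fermat₂ p-prime (<-trans (n<1+n 2) 3<p))

  4^[4n]≡1+8qp : T ≡ 1 + 8 * (q * p) [mod p * p ]
  4^[4n]≡1+8qp = begin
    4 ^ (4 * n)        ≡⟨ ^-*-assoc 2 2 (4 * n) ⟩
    2 ^ (2 * (4 * n))  ≡⟨ cong (2 ^_) (2*[4*n]≡n*8 n) ⟩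
    2 ^ (n * 8)        ≡⟨ ^-*-assoc 2 n 8 ⟨
    (2 ^ n) ^ 8        ≡⟨ cong (_^ 8) 2^n≡1+qp ⟩
    (1 + q * p) ^ 8    ≈⟨ [1+x]^e≡1+ex {x = q * p} 8 (divides (q * q) (qp*qp≡q*q*[p*p] q p)) ⟩
    1 + 8 * (q * p)    ∎
    where
    open SetoidReasoning (≡-mod-setoid (p * p))
    2*[4*n]≡n*8 : ∀ n → 2 * (4 * n) ≡ n * 8
    2*[4*n]≡n*8 = solve-∀
    qp*qp≡q*q*[p*p] : ∀ q p → q * p * (q * p) ≡ q * q * (p * p)
    qp*qp≡q*q*[p*p] = solve-∀

  diagonal-key : N + T * Rb ≡ T * Ra [mod p ^ 4 ]
  diagonal-key = begin
    N + T * Rb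
      ≈⟨ +-cong-mod (mod-≡ {N} refl) (*-congʳ-mod Rb (p⁴∣p²*15p²r (9 + 6 * p)) 4^[4n]≡1+8qp) ⟩
    N + u * Rb
      ≈⟨ +-∣-modʳ (N + u * Rb) (n∣m*n (960 * (q * q))) ⟨
    N + u * Rb + 960 * (q * q) * p ^ 4
      ≡⟨ rearrange N q p ⟩
    (N + c) + (u * Ra′ + 720 * q * p ^ 4)
      ≈⟨ +-∣-modˡ (u * Ra′ + 720 * q * p ^ 4) (diagonal-congruence n p-prime 3<p) ⟩
    u * Ra′ + 720 * q * p ^ 4
      ≈⟨ +-∣-modʳ (u * Ra′) (n∣m*n (720 * q)) ⟩
    u * Ra′
      ≡⟨ cong (λ x → u * (15 * p ^ 2 * (8 * x))) 2^n≡1+qp ⟨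
    u * Ra
      ≈⟨ *-congʳ-mod Ra (p⁴∣p²*15p²r (8 * 2 ^ n)) 4^[4n]≡1+8qp ⟨
    T * Ra ∎
    where
    open SetoidReasoning (≡-mod-setoid (p ^ 4))
    u = 1 + 8 * (q * p)
    c = 15 * p ^ 2 * (1 + 6 * p)
    Ra′ = 15 * p ^ 2 * (8 * (1 + q * p))
    p⁴∣p²*15p²r : ∀ r → p ^ 4 ∣ p * p * (15 * p ^ 2 * r)
    p⁴∣p²*15p²r r = divides (15 * r) (regroup p r)
      where
      regroup : ∀ p r → p * p * (15 * (p * (p * 1)) * r) ≡ 15 * r * (p * (p * (p * (p * 1))))
      regroup = solve-∀
    rearrange : ∀ N q p → N + (1 + 8 * (q * p)) * (15 * (p * (p * 1)) * (9 + 6 * p)) + 960 * (q * q) * (p * (p * (p * (p * 1))))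
                            ≡ (N + 15 * (p * (p * 1)) * (1 + 6 * p))
                              + ((1 + 8 * (q * p)) * (15 * (p * (p * 1)) * (8 * (1 + q * p))) + 720 * q * (p * (p * (p * (p * 1)))))
    rearrange = solve-∀

  congMod-diagonal : CongMod p (frac (ℤ.+ N) T) (frac (ℤ.+ Ra ℤ.- ℤ.+ Rb) 1) (p ^ 4)
  congMod-diagonal = congMod-frac {a = ℤ.+ N} {b = ℤ.+ Ra ℤ.- ℤ.+ Rb} {{m^n≢0 4 (4 * n)}} p-prime (∤-^ p-prime p∤4 (4 * n))
    (subst (ℤ.+ (p ^ 4) ∣ℤ_) integer-form (≡-mod⇒∣- diagonal-key))
    where
    p∤4 : p ∤ 4
    p∤4 = ∤-* p-prime p∤2 p∤2
      where p∤2 = <⇒∤ z<s (<-trans (n<1+n 2) 3<p)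
    integer-form : ℤ.+ (N + T * Rb) ℤ.- ℤ.+ (T * Ra) ≡ ℤ.+ N ℤ.- (ℤ.+ Ra ℤ.- ℤ.+ Rb) ℤ.* ℤ.+ T
    integer-form = trans (cong₂ (λ x y → ℤ.+ N ℤ.+ x ℤ.- y) (ℤ.pos-* T Rb) (ℤ.pos-* T Ra))
                         (regroup (ℤ.+ N) (ℤ.+ T) (ℤ.+ Ra) (ℤ.+ Rb))
      where
      regroup : ∀ x t a b → x ℤ.+ t ℤ.* b ℤ.- t ℤ.* a ≡ x ℤ.- (a ℤ.- b) ℤ.* t
      regroup = ℤ-Solver.solve-∀

open import Data.Integer using (+_)

lemma3p1 : (p : ℕ) → Prime p → p ℕ.> 3 →
    CongMod p (F (p ℕ.∸ 1) (p ℕ.∸ 1))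
      (frac (+ (15 ℕ.* p ℕ.^ 2)) 1
        ℚ.* ((ℚ.- frac (+ 1) 1 ℚ.- frac (+ (6 ℕ.* p)) 1)
           ℚ.+ frac (+ (8 ℕ.* p)) 1 ℚ.* fermatQuotient2 p))
      (p ℕ.^ 4)
lemma3p1 (suc n) p-prime 3<p =
  subst₂ (λ x y → CongMod (suc n) x y (suc n ^ 4)) (sym (F-diagonal n)) (sym (rhs-integral n))
    (congMod-diagonal p-prime 3<p)
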